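{- Let $m,n$ be positive integers with $$m>\prod_{p\le n,\ p \text{ prime}} p^{\lfloor \log_p n\rfloor}.$$ Then the binomial coefficient $\binom{m+n}{n}$ can be written as $$\binom{m+n}{n}=\prod_{i=1}^{n}a_i,$$ where $a_1,\dots,a_n$ are positive integers such that $a_i\mid (m+i)$ and $a_i>1$ for every $1\le i\le n$, and $\gcd(a_i,a_j)=1$ for all $1\le i\ne j\le n$.
   Context: $\lfloor x\rfloor$ denotes the largest integer not exceeding the real number $x$, and the product runs over all primes $p\le n$ (an empty product equals $1$). -}

module Defs where

open import Data.Nat using (ℕ; zero; suc; _+_; _*_; _^_; _≤?_)
open import Data.Nat.Primality using (prime?)
open import Relation.Nullary using (yes; no)

-- ⌊log_p n⌋ for p ≥ 2 and n ≥ 1: the largest k with p ^ k ≤ n.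
-- Computed as the number of k ∈ {1, …, n} with p ^ k ≤ n
-- (for p ≥ 2, p ^ k ≤ n forces k < n + 1 and the set of such k is
-- downward closed, so this count is exactly the largest such k).
countPow : ℕ → ℕ → ℕ → ℕ
countPow p n zero = 0
countPow p n (suc k) with p ^ suc k ≤? n
... | yes _ = suc (countPow p n k)
... | no _  = countPow p n k

floorLog : ℕ → ℕ → ℕ
floorLog p n = countPow p n n

primePowProdUpTo : ℕ → ℕ → ℕ
primePowProdUpTo n zero = 1
primePowProdUpTo n (suc k) with prime? (suc k)
... | yes _ = (suc k) ^ floorLog (suc k) n * primePowProdUpTo n k
... | no _  = primePowProdUpTo n k

primePowProd : ℕ → ℕ
primePowProd n = primePowProdUpTo n n

{-# OPTIONS --safe #-}
-- For a prime p let i_p be a position 1 ≤ i ≤ n where ν_p (m + i) is largest. On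
-- either side of such a peak, p ^ ν_p (m + i_p ± d) divides d, so comparing
-- ν_p ((m + 1) ⋯ (m + n)) = ν_p (C(m + n, n)) + ν_p (n!) with the factorials of the two
-- sides gives ν_p (C(m + n, n)) ≤ ν_p (m + i_p). Hence putting the whole p-part of
-- C(m + n, n) into a_{i_p} gives pairwise coprime a_i ∣ m + i with product C(m + n, n).
-- If some a_i were 1, no prime power p ^ (⌊log_p n⌋ + 1) could divide m + i: it exceeds
-- n, so it divides at most one of the m + j, namely m + i_p, and then it forces p to
-- divide C(m + n, n), so p ∣ a_{i_p} = a_i. Then m + i would divide
-- ∏ p ^ ⌊log_p n⌋ < m.
module Submission where

open import Defs
import Algebra.Properties.CommutativeSemigroup as CommSemigroupProperties
open import Data.Empty using (⊥; ⊥-elim)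
open import Data.Fin using (Fin; zero; suc; toℕ; fromℕ<) renaming (_≟_ to _≟ᶠ_)
open import Data.Fin.Properties using (toℕ-fromℕ<; toℕ-injective; toℕ<n)
open import Data.List.Base using ([]; _∷_)
open import Data.List.Relation.Unary.All using (_∷_)
open import Data.Nat
open import Data.Nat.Combinatorics using (_C_; nCk≡n!/k![n-k]!; k![n∸k]!∣n!)
open import Data.Nat.Coprimality using (Coprime; coprime-divisor; coprime⇒gcd≡1)
open import Data.Nat.Divisibility
open import Data.Nat.DivMod using (m/n*n≡m)
open import Data.Nat.GCD using (gcd)
open import Data.Nat.Induction using (<-wellFounded)
open import Data.Nat.ListAction using (product)
open import Data.Nat.Primality
open import Data.Nat.Primality.Factorisation using (factorise)
open import Data.Nat.Properties
open import Data.Product using (Σ; ∃-syntax; _×_; _,_)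
open import Data.Sum using (_⊎_; inj₁; inj₂)
open import Data.Vec.Functional using (foldr; updateAt)
open import Data.Vec.Functional.Properties using (updateAt-updates; updateAt-minimal)
open import Function using (_∘_)
open import Induction.WellFounded using (Acc; acc)
open import Relation.Binary.Definitions using (tri<; tri≈; tri>)
open import Relation.Binary.PropositionalEquality
open import Relation.Nullary using (¬_; yes; no; contradiction)

open CommSemigroupProperties *-commutativeSemigroup using (interchange; xy∙z≈xz∙y; x∙yz≈y∙xz)
open CommSemigroupProperties +-commutativeSemigroup
  using () renaming (x∙yz≈z∙xy to x+[y+z]≡z+[x+y]; x∙yz≈y∙xz to x+[y+z]≡y+[x+z])

private
  variable
    p q d e k r x y : ℕ

m*n>0 : 0 < x → 0 < y → 0 < x * y
m*n>0 {suc _} {suc _} _ _ = z<s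

0<m+1+n : ∀ m n → 0 < m + suc n
0<m+1+n m n = subst (0 <_) (sym (+-suc m n)) z<s

prime⇒1< : Prime p → 1 < p
prime⇒1< {p} pp = nonTrivial⇒n>1 p {{prime⇒nonTrivial pp}}

prime∤1 : Prime p → ¬ p ∣ 1
prime∤1 pp p∣1 = >⇒≢ (prime⇒1< pp) (∣1⇒≡1 p∣1)

∃-prime∣ : 1 < x → ∃[ p ] Prime p × p ∣ x
∃-prime∣ {x} 1<x with factorise x {{>-nonZero (<-trans z<s 1<x)}}
... | record { factors = [] ; isFactorisation = x≡1 } = contradiction x≡1 (>⇒≢ 1<x)
... | record { factors = p ∷ ps ; isFactorisation = x≡ ; factorsPrime = pp ∷ _ } =
  p , pp , subst (p ∣_) (sym x≡) (m∣m*n (product ps))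

^-monoʳ-∣ : ∀ p {j k} → j ≤ k → p ^ j ∣ p ^ k
^-monoʳ-∣ p {k = k} z≤n       = 1∣ (p ^ k)
^-monoʳ-∣ p         (s≤s j≤k) = *-monoʳ-∣ p (^-monoʳ-∣ p j≤k)

prime∣prime^⇒≡ : Prime q → Prime p → ∀ e → q ∣ p ^ e → q ≡ p
prime∣prime^⇒≡ qp pp zero q∣1 = contradiction q∣1 (prime∤1 qp)
prime∣prime^⇒≡ {p = p} qp pp (suc e) q∣pᵉ⁺¹ with euclidsLemma p (p ^ e) qp q∣pᵉ⁺¹
... | inj₂ q∣pᵉ = prime∣prime^⇒≡ qp pp e q∣pᵉ
... | inj₁ q∣p with prime⇒irreducible pp q∣p
...   | inj₁ q≡1 = contradiction q≡1 (>⇒≢ (prime⇒1< qp))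
...   | inj₂ q≡p = q≡p

noCommonPrime⇒coprime : (∀ q → Prime q → q ∣ x → q ∣ y → ⊥) → Coprime x y
noCommonPrime⇒coprime h {zero} (0∣x , 0∣y) = ⊥-elim (h 2 prime[2] (2∣ 0∣x) (2∣ 0∣y))
  where
  2∣ : ∀ {z} → 0 ∣ z → 2 ∣ z
  2∣ 0∣z = subst (2 ∣_) (sym (0∣⇒≡0 0∣z)) (2 ∣0)
noCommonPrime⇒coprime h {1} _ = refl
noCommonPrime⇒coprime h {d@(suc (suc _))} (d∣x , d∣y) with ∃-prime∣ {d} (s<s z<s)
... | q , qp , q∣d = ⊥-elim (h q qp (∣-trans q∣d d∣x) (∣-trans q∣d d∣y))

prime^*∣ : Prime p → p ^ e ∣ x → r ∣ x → ¬ p ∣ r → p ^ e * r ∣ x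
prime^*∣ {p} {e} {r = r} pp pᵉ∣x (divides t refl) p∤r =
  subst (p ^ e * r ∣_) (*-comm r t) (subst (_∣ r * t) (*-comm r (p ^ e)) (*-monoʳ-∣ r pᵉ∣t))
  where
  pᵉ⊥r : Coprime (p ^ e) r
  pᵉ⊥r = noCommonPrime⇒coprime λ q qp q∣pᵉ q∣r →
    p∤r (subst (_∣ r) (prime∣prime^⇒≡ qp pp e q∣pᵉ) q∣r)
  pᵉ∣t : p ^ e ∣ t
  pᵉ∣t = coprime-divisor pᵉ⊥r (subst (p ^ e ∣_) (*-comm t r) pᵉ∣x)

-- p-adic valuation

-- Trial division with fuel x; since p ≥ 2 the quotients strictly decrease, so the
-- fuel never runs out for x ≥ 1. Junk value: ν p 0 = 0.
valuationWithin : ℕ → ℕ → ℕ → ℕ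
valuationWithin p zero    x = 0
valuationWithin p (suc f) x with p ∣? x
... | yes p∣x = suc (valuationWithin p f (quotient p∣x))
... | no  _   = 0

ν : ℕ → ℕ → ℕ
ν p x = valuationWithin p x x

module _ {p : ℕ} (pp : Prime p) where

  private instance
    p≢0 : NonZero p
    p≢0 = prime⇒nonZero pp

  private
    split-within : ∀ f → 0 < x → x ≤ f → ∃[ r ] x ≡ p ^ valuationWithin p f x * r × ¬ p ∣ r
    split-within zero 0<x x≤0 = contradiction x≤0 (<⇒≱ 0<x)
    split-within {x} (suc f) 0<x x≤f with p ∣? x
    ... | no p∤x = x , sym (*-identityˡ x) , p∤x
    ... | yes (divides zero refl) = contradiction 0<x (<-irrefl refl)
    ... | yes (divides t@(suc _) refl)
          with split-within f z<s (s≤s⁻¹ (≤-trans (m<m*n t p (prime⇒1< pp)) x≤f))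
    ...   | r , t≡ , p∤r = r , t*p≡ , p∤r
      where
      open ≡-Reasoning
      v = valuationWithin p f t
      t*p≡ : t * p ≡ p * p ^ v * r
      t*p≡ = begin
        t * p         ≡⟨ cong (_* p) t≡ ⟩
        p ^ v * r * p ≡⟨ xy∙z≈xz∙y (p ^ v) r p ⟩
        p ^ v * p * r ≡⟨ cong (_* r) (*-comm (p ^ v) p) ⟩
        p * p ^ v * r ∎

  ν-split : 0 < x → ∃[ r ] x ≡ p ^ ν p x * r × ¬ p ∣ r
  ν-split 0<x = split-within _ 0<x ≤-refl

  ^ν∣ : ∀ x → p ^ ν p x ∣ x
  ^ν∣ zero      = 1∣ 0
  ^ν∣ x@(suc _) with ν-split z<s
  ... | r , x≡ , _ = subst (p ^ ν p x ∣_) (sym x≡) (m∣m*n r)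

  pᵏ∣pᵉ*r⇒k≤e : ∀ k e → ¬ p ∣ r → p ^ k ∣ p ^ e * r → k ≤ e
  pᵏ∣pᵉ*r⇒k≤e {r} k e p∤r pᵏ∣ with k ≤? e
  ... | yes k≤e = k≤e
  ... | no  k≰e = contradiction (*-cancelˡ-∣ (p ^ e) {{m^n≢0 p e}} pᵉ*p∣pᵉ*r) p∤r
    where
    pᵉ*p∣pᵉ*r : p ^ e * p ∣ p ^ e * r
    pᵉ*p∣pᵉ*r = subst (_∣ p ^ e * r) (*-comm p (p ^ e)) (∣-trans (^-monoʳ-∣ p (≰⇒> k≰e)) pᵏ∣)

  ^∣⇒≤ν : 0 < x → p ^ k ∣ x → k ≤ ν p x
  ^∣⇒≤ν {x} {k} 0<x pᵏ∣x with ν-split 0<x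
  ... | r , x≡ , p∤r = pᵏ∣pᵉ*r⇒k≤e k (ν p x) p∤r (subst (p ^ k ∣_) x≡ pᵏ∣x)

  ≤ν⇒^∣ : ∀ x → k ≤ ν p x → p ^ k ∣ x
  ≤ν⇒^∣ x k≤ν = ∣-trans (^-monoʳ-∣ p k≤ν) (^ν∣ x)

  ν-mono-∣ : 0 < y → x ∣ y → ν p x ≤ ν p y
  ν-mono-∣ {x = x} 0<y x∣y = ^∣⇒≤ν 0<y (∣-trans (^ν∣ x) x∣y)

  ν[pᵉ*r]≡e : ∀ e → ¬ p ∣ r → ν p (p ^ e * r) ≡ e
  ν[pᵉ*r]≡e {zero}      e p∤r = contradiction (p ∣0) p∤r
  ν[pᵉ*r]≡e {r@(suc _)} e p∤r = ≤-antisym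
    (pᵏ∣pᵉ*r⇒k≤e _ e p∤r (^ν∣ (p ^ e * r)))
    (^∣⇒≤ν (m*n>0 (m^n>0 p e) z<s) (m∣m*n r))

  ν-* : 0 < x → 0 < y → ν p (x * y) ≡ ν p x + ν p y
  ν-* {x} {y} 0<x 0<y with ν-split 0<x | ν-split 0<y
  ... | r , x≡ , p∤r | s , y≡ , p∤s = begin
    ν p (x * y)                           ≡⟨ cong₂ (λ a b → ν p (a * b)) x≡ y≡ ⟩
    ν p (pᵃ * r * (pᵇ * s))               ≡⟨ cong (ν p) (interchange pᵃ r pᵇ s) ⟩
    ν p (pᵃ * pᵇ * (r * s))               ≡⟨ cong (λ t → ν p (t * (r * s))) pᵃ⁺ᵇ≡pᵃ*pᵇ ⟨
    ν p (p ^ (ν p x + ν p y) * (r * s))   ≡⟨ ν[pᵉ*r]≡e _ p∤rs ⟩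
    ν p x + ν p y                         ∎
    where
    open ≡-Reasoning
    pᵃ = p ^ ν p x
    pᵇ = p ^ ν p y
    pᵃ⁺ᵇ≡pᵃ*pᵇ = ^-distribˡ-+-* p (ν p x) (ν p y)
    p∤rs : ¬ p ∣ r * s
    p∤rs p∣rs with euclidsLemma r s pp p∣rs
    ... | inj₁ p∣r = p∤r p∣r
    ... | inj₂ p∣s = p∤s p∣s

  ν-+-cancelˡ : ∀ u w → 0 < w → k ≤ ν p (u + w) → k ≤ ν p u → k ≤ ν p w
  ν-+-cancelˡ u w 0<w k≤νu+w k≤νu =
    ^∣⇒≤ν 0<w (∣m+n∣m⇒∣n (≤ν⇒^∣ (u + w) k≤νu+w) (≤ν⇒^∣ u k≤νu))

  <p^suc⇒ν≤ : 0 < d → d < p ^ suc k → ν p d ≤ k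
  <p^suc⇒ν≤ {d} {k} 0<d d<pᵏ⁺¹ with ν p d ≤? k
  ... | yes ν≤k = ν≤k
  ... | no  ν≰k = contradiction (≤-trans (^-monoʳ-≤ p (≰⇒> ν≰k)) pᵛ≤d) (<⇒≱ d<pᵏ⁺¹)
    where pᵛ≤d = ∣⇒≤ {{>-nonZero 0<d}} (^ν∣ d)

primePower-induction : ∀ {ℓ} (P : ℕ → Set ℓ) → P 1 →
  (∀ p e r → Prime p → ¬ p ∣ r → 0 < r → P r → P (p ^ e * r)) →
  ∀ x → 0 < x → P x
primePower-induction P P1 step x 0<x = go x 0<x (<-wellFounded x)
  where
  go : ∀ x → 0 < x → Acc _<_ x → P x
  go 1               _ _         = P1
  go x@(suc (suc _)) _ (acc rec) with ∃-prime∣ {x} (s<s z<s)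
  ... | p , pp , p∣x with ν-split pp {x} z<s
  ...   | zero , x≡ , _ = contradiction (trans x≡ (*-zeroʳ (p ^ ν p x))) λ ()
  ...   | r@(suc _) , x≡ , p∤r =
    subst P (sym x≡) (step p (ν p x) r pp p∤r z<s (go r z<s (rec r<x)))
    where
    instance _ = prime⇒nonZero pp
    1≤ν : 1 ≤ ν p x
    1≤ν = ^∣⇒≤ν pp {k = 1} z<s (subst (_∣ x) (sym (*-identityʳ p)) p∣x)
    1<pᵉ : 1 < p ^ ν p x
    1<pᵉ = <-≤-trans (prime⇒1< pp) (subst (_≤ p ^ ν p x) (*-identityʳ p) (^-monoʳ-≤ p 1≤ν))
    r<x : r < x
    r<x = subst (r <_) (trans (*-comm r _) (sym x≡)) (m<m*n r (p ^ ν p x) 1<pᵉ)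

^ν∣⇒∣ : 0 < x → (∀ q → Prime q → q ^ ν q x ∣ y) → x ∣ y
^ν∣⇒∣ {x} {y} 0<x =
  primePower-induction (λ x → (∀ q → Prime q → q ^ ν q x ∣ y) → x ∣ y) (λ _ → 1∣ y) step x 0<x
  where
  step : ∀ p e r → Prime p → ¬ p ∣ r → 0 < r →
         ((∀ q → Prime q → q ^ ν q r ∣ y) → r ∣ y) →
         (∀ q → Prime q → q ^ ν q (p ^ e * r) ∣ y) → p ^ e * r ∣ y
  step p e r pp p∤r 0<r ih h = prime^*∣ {e = e} pp pᵉ∣y (ih hʳ) p∤r
    where
    instance _ = prime⇒nonZero pp
    pᵉ∣y : p ^ e ∣ y
    pᵉ∣y = subst (λ k → p ^ k ∣ y) (ν[pᵉ*r]≡e pp e p∤r) (h p pp)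
    hʳ : ∀ q → Prime q → q ^ ν q r ∣ y
    hʳ q qp = ∣-trans (^-monoʳ-∣ q (ν-mono-∣ qp (m*n>0 (m^n>0 p e) 0<r) (n∣m*n (p ^ e)))) (h q qp)

-- Valuations of blocks of consecutive integers

argmax : (ℕ → ℕ) → ℕ → ℕ
argmax f zero    = zero
argmax f (suc k) with f (argmax f k) ≤? f (suc k)
... | yes _ = suc k
... | no  _ = argmax f k

argmax≤ : ∀ (f : ℕ → ℕ) k → argmax f k ≤ k
argmax≤ f zero    = z≤n
argmax≤ f (suc k) with f (argmax f k) ≤? f (suc k)
... | yes _ = ≤-refl
... | no  _ = m≤n⇒m≤1+n (argmax≤ f k)

argmax-maximal : ∀ (f : ℕ → ℕ) k {i} → i ≤ k → f i ≤ f (argmax f k)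
argmax-maximal f zero    z≤n = ≤-refl
argmax-maximal f (suc k) i≤  with f (argmax f k) ≤? f (suc k) | m≤n⇒m<n∨m≡n i≤
... | yes fa≤ | inj₁ i<   = ≤-trans (argmax-maximal f k (s≤s⁻¹ i<)) fa≤
... | yes _   | inj₂ refl = ≤-refl
... | no  _   | inj₁ i<   = argmax-maximal f k (s≤s⁻¹ i<)
... | no  fa≰ | inj₂ refl = <⇒≤ (≰⇒> fa≰)

peak : ℕ → ℕ → ℕ → ℕ
peak p M = argmax (λ i → ν p (M + suc i))

C*!*!≡! : ∀ M L → ((M + L) C L) * (L ! * M !) ≡ (M + L) !
C*!*!≡! M L = begin
  ((M + L) C L) * (L ! * M !)                   ≡⟨ cong (λ t → ((M + L) C L) * (L ! * t !)) (m+n∸n≡m M L) ⟨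
  ((M + L) C L) * L![M+L∸L]!                    ≡⟨ cong (_* L![M+L∸L]!) (nCk≡n!/k![n-k]! L≤M+L) ⟩
  (M + L) ! / L![M+L∸L]! * L![M+L∸L]!           ≡⟨ m/n*n≡m (k![n∸k]!∣n! L≤M+L) ⟩
  (M + L) !                                     ∎
  where
  open ≡-Reasoning
  instance _ = L !* (M + L ∸ L) !≢0
  L![M+L∸L]! = L ! * (M + L ∸ L) !
  L≤M+L = m≤n+m L M

C>0 : ∀ M L → 0 < (M + L) C L
C>0 M L = n≢0⇒n>0 λ C≡0 → >⇒≢ (1≤n! (M + L))
  (trans (sym (C*!*!≡! M L)) (cong (_* (L ! * M !)) C≡0))

module Blocks {p : ℕ} (pp : Prime p) where

  νBlock : ℕ → ℕ → ℕ
  νBlock M zero    = 0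
  νBlock M (suc L) = νBlock M L + ν p (M + suc L)

  νFact : ℕ → ℕ
  νFact = νBlock 0

  νBlock-+ : ∀ M a b → νBlock M (a + b) ≡ νBlock M a + νBlock (M + a) b
  νBlock-+ M a zero    = trans (cong (νBlock M) (+-identityʳ a)) (sym (+-identityʳ _))
  νBlock-+ M a (suc b) = begin
    νBlock M (a + suc b)                                ≡⟨ cong (νBlock M) (+-suc a b) ⟩
    νBlock M (a + b) + ν p (M + suc (a + b))            ≡⟨ cong₂ _+_ (νBlock-+ M a b) (cong (ν p) shift) ⟩
    νBlock M a + νBlock (M + a) b + ν p (M + a + suc b) ≡⟨ +-assoc (νBlock M a) _ _ ⟩
    νBlock M a + νBlock (M + a) (suc b)                 ∎
    where
    open ≡-Reasoning
    shift : M + suc (a + b) ≡ M + a + suc b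
    shift = trans (cong (M +_) (sym (+-suc a b))) (sym (+-assoc M a (suc b)))

  νBlock-suc : ∀ M L → νBlock M (suc L) ≡ ν p (suc M) + νBlock (suc M) L
  νBlock-suc M L = trans (νBlock-+ M 1 L) (cong (λ z → ν p z + νBlock z L) (+-comm M 1))

  νBlock-split : ∀ M a b →
    νBlock M (a + suc b) ≡ νBlock M a + (ν p (M + suc a) + νBlock (M + suc a) b)
  νBlock-split M a b = trans (νBlock-+ M a (suc b)) (cong (νBlock M a +_)
    (trans (νBlock-suc (M + a) b) (cong (λ z → ν p z + νBlock z b) (sym (+-suc M a)))))

  ν-! : ∀ k → ν p (k !) ≡ νFact k
  ν-! zero    = ν[pᵉ*r]≡e pp 0 (prime∤1 pp)
  ν-! (suc k) = begin
    ν p (suc k * k !)       ≡⟨ ν-* pp z<s (1≤n! k) ⟩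
    ν p (suc k) + ν p (k !) ≡⟨ cong (ν p (suc k) +_) (ν-! k) ⟩
    ν p (suc k) + νFact k   ≡⟨ +-comm (ν p (suc k)) (νFact k) ⟩
    νFact (suc k)           ∎
    where open ≡-Reasoning

  νBlock≡ν[C]+νFact : ∀ M L → νBlock M L ≡ ν p ((M + L) C L) + νFact L
  νBlock≡ν[C]+νFact M L = +-cancelˡ-≡ (νFact M) _ _ (begin
    νFact M + νBlock M L                ≡⟨ νBlock-+ 0 M L ⟨
    νFact (M + L)                       ≡⟨ ν-! (M + L) ⟨
    ν p ((M + L) !)                     ≡⟨ cong (ν p) (C*!*!≡! M L) ⟨
    ν p (((M + L) C L) * (L ! * M !))   ≡⟨ ν-* pp (C>0 M L) (m*n>0 (1≤n! L) (1≤n! M)) ⟩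
    νC + ν p (L ! * M !)                ≡⟨ cong (νC +_) (ν-* pp (1≤n! L) (1≤n! M)) ⟩
    νC + (ν p (L !) + ν p (M !))        ≡⟨ cong (νC +_) (cong₂ _+_ (ν-! L) (ν-! M)) ⟩
    νC + (νFact L + νFact M)            ≡⟨ x+[y+z]≡z+[x+y] νC (νFact L) (νFact M) ⟩
    νFact M + (νC + νFact L)            ∎)
    where
    open ≡-Reasoning
    νC = ν p ((M + L) C L)

  νFact≤νBlock : ∀ M L → νFact L ≤ νBlock M L
  νFact≤νBlock M L = subst (νFact L ≤_) (sym (νBlock≡ν[C]+νFact M L)) (m≤n+m (νFact L) _)

  νFact-superadditive : ∀ a b → νFact a + νFact b ≤ νFact (a + b)
  νFact-superadditive a b = subst (νFact a + νFact b ≤_) (sym (νBlock-+ 0 a b))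
    (+-monoʳ-≤ (νFact a) (νFact≤νBlock a b))

  -- Next to a peak z each term has ν p (z ∓ d) ≤ ν p d, as p ^ ν p (z ∓ d) also divides z.
  νBlock-before-peak : ∀ k M → (∀ i → i < k → ν p (M + suc i) ≤ ν p (M + suc k)) →
                       νBlock M k ≤ νFact k
  νBlock-before-peak zero    M h = z≤n
  νBlock-before-peak (suc k) M h = begin
    νBlock M (suc k)               ≡⟨ νBlock-suc M k ⟩
    ν p (suc M) + νBlock (suc M) k ≤⟨ +-mono-≤ first (νBlock-before-peak k (suc M) hˢ) ⟩
    ν p (suc k) + νFact k          ≡⟨ +-comm (ν p (suc k)) (νFact k) ⟩
    νFact (suc k)                  ∎
    where
    open ≤-Reasoning
    shift : ∀ i → M + suc (suc i) ≡ suc M + suc i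
    shift i = +-suc M (suc i)
    hˢ : ∀ i → i < k → ν p (suc M + suc i) ≤ ν p (suc M + suc k)
    hˢ i i<k = subst₂ (λ u w → ν p u ≤ ν p w) (shift i) (shift k) (h (suc i) (s<s i<k))
    first : ν p (suc M) ≤ ν p (suc k)
    first = ν-+-cancelˡ pp (suc M) (suc k) z<s
      (subst₂ (λ u w → ν p u ≤ ν p w) (+-comm M 1) (shift k) (h 0 z<s)) ≤-refl

  νBlock-after-peak : ∀ k z → (∀ d → d < k → ν p (z + suc d) ≤ ν p z) → νBlock z k ≤ νFact k
  νBlock-after-peak zero    z h = z≤n
  νBlock-after-peak (suc k) z h =
    +-mono-≤ (νBlock-after-peak k z λ d d<k → h d (m<n⇒m<1+n d<k))
             (ν-+-cancelˡ pp z (suc k) z<s ≤-refl (h k ≤-refl))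

  peak⇒νBlock≤ν+νFact : ∀ M a b → (∀ i → i ≤ a + b → ν p (M + suc i) ≤ ν p (M + suc a)) →
                        νBlock M (a + suc b) ≤ ν p (M + suc a) + νFact (a + b)
  peak⇒νBlock≤ν+νFact M a b h = begin
    νBlock M (a + suc b)                     ≡⟨ νBlock-split M a b ⟩
    νBlock M a + (νz + νBlock (M + suc a) b) ≤⟨ +-mono-≤ before (+-monoʳ-≤ νz after) ⟩
    νFact a + (νz + νFact b)                 ≡⟨ x+[y+z]≡y+[x+z] (νFact a) νz (νFact b) ⟩
    νz + (νFact a + νFact b)                 ≤⟨ +-monoʳ-≤ νz (νFact-superadditive a b) ⟩
    νz + νFact (a + b)                       ∎
    where
    open ≤-Reasoning
    νz = ν p (M + suc a)
    before : νBlock M a ≤ νFact a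
    before = νBlock-before-peak a M λ i i<a → h i (≤-trans (<⇒≤ i<a) (m≤m+n a b))
    after : νBlock (M + suc a) b ≤ νFact b
    after = νBlock-after-peak b (M + suc a) λ d d<b →
      subst (λ z → ν p z ≤ νz) (sym (+-assoc M (suc a) (suc d))) (h (a + suc d) (+-monoʳ-≤ a d<b))

  ν+νFact+νFact≤νBlock : ∀ M a b → ν p (M + suc a) + (νFact a + νFact b) ≤ νBlock M (a + suc b)
  ν+νFact+νFact≤νBlock M a b = begin
    νz + (νFact a + νFact b)                 ≡⟨ x+[y+z]≡y+[x+z] νz (νFact a) (νFact b) ⟩
    νFact a + (νz + νFact b)                 ≤⟨ +-mono-≤ (νFact≤νBlock M a)
                                                         (+-monoʳ-≤ νz (νFact≤νBlock (M + suc a) b)) ⟩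
    νBlock M a + (νz + νBlock (M + suc a) b) ≡⟨ νBlock-split M a b ⟨
    νBlock M (a + suc b)                     ∎
    where
    open ≤-Reasoning
    νz = ν p (M + suc a)

  νBlock≤ν[peak]+νFact : ∀ M L → νBlock M (suc L) ≤ ν p (M + suc (peak p M L)) + νFact L
  νBlock≤ν[peak]+νFact M L =
    subst₂ _≤_ (cong (νBlock M) a+[1+b]≡1+L) (cong (λ t → ν p (M + suc a) + νFact t) a+b≡L)
      (peak⇒νBlock≤ν+νFact M a b λ i i≤a+b → argmax-maximal _ L (subst (i ≤_) a+b≡L i≤a+b))
    where
    a = peak p M L
    b = L ∸ a
    a+b≡L : a + b ≡ L
    a+b≡L = m+[n∸m]≡n (argmax≤ _ L)
    a+[1+b]≡1+L : a + suc b ≡ suc L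
    a+[1+b]≡1+L = trans (+-suc a b) (cong suc a+b≡L)

  ν[C]≤ν[peak] : ∀ M L → ν p ((M + suc L) C (suc L)) ≤ ν p (M + suc (peak p M L))
  ν[C]≤ν[peak] M L = +-cancelʳ-≤ (νFact (suc L)) _ _ (begin
    νC + νFact (suc L)    ≡⟨ νBlock≡ν[C]+νFact M (suc L) ⟨
    νBlock M (suc L)      ≤⟨ νBlock≤ν[peak]+νFact M L ⟩
    νpeak + νFact L       ≤⟨ +-monoʳ-≤ νpeak (m≤m+n (νFact L) _) ⟩
    νpeak + νFact (suc L) ∎)
    where
    open ≤-Reasoning
    νC = ν p ((M + suc L) C (suc L))
    νpeak = ν p (M + suc (peak p M L))

  νFact[a+1+b]≤K+νFact[a]+νFact[b] : ∀ a b K → a + suc b < p ^ suc K →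
                                     νFact (a + suc b) ≤ K + (νFact a + νFact b)
  νFact[a+1+b]≤K+νFact[a]+νFact[b] a b K a+[1+b]<pᴷ⁺¹ = begin
    νFact (a + suc b)                      ≡⟨ cong νFact (a+[1+b]≡b+[1+a] a b) ⟩
    νFact (b + suc a)                      ≡⟨ νBlock-+ 0 b (suc a) ⟩
    νFact b + νBlock b (suc a)             ≤⟨ +-monoʳ-≤ (νFact b) (νBlock≤ν[peak]+νFact b a) ⟩
    νFact b + (ν p peakTerm + νFact a)     ≤⟨ +-monoʳ-≤ (νFact b) (+-monoˡ-≤ (νFact a) νpeak≤K) ⟩
    νFact b + (K + νFact a)                ≡⟨ x+[y+z]≡y+[x+z] (νFact b) K (νFact a) ⟩
    K + (νFact b + νFact a)                ≡⟨ cong (K +_) (+-comm (νFact b) (νFact a)) ⟩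
    K + (νFact a + νFact b)                ∎
    where
    open ≤-Reasoning
    a+[1+b]≡b+[1+a] : ∀ a b → a + suc b ≡ b + suc a
    a+[1+b]≡b+[1+a] a b = trans (+-suc a b) (trans (cong suc (+-comm a b)) (sym (+-suc b a)))
    peakTerm = b + suc (peak p b a)
    νpeak≤K : ν p peakTerm ≤ K
    νpeak≤K = <p^suc⇒ν≤ pp (0<m+1+n b _) (begin-strict
      peakTerm  ≤⟨ +-monoʳ-≤ b (s≤s (argmax≤ _ a)) ⟩
      b + suc a ≡⟨ a+[1+b]≡b+[1+a] a b ⟨
      a + suc b <⟨ a+[1+b]<pᴷ⁺¹ ⟩
      p ^ suc K ∎)

  -- ν p (M + 1 + a) > K, while ν p ((a + 1 + b)!) exceeds ν p (a!) + ν p (b!) by at most K.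
  bigPower⇒p∣C : ∀ M L a K → a ≤ L → suc L < p ^ suc K → p ^ suc K ∣ M + suc a →
                 p ∣ (M + suc L) C (suc L)
  bigPower⇒p∣C M L a K a≤L 1+L<pᴷ⁺¹ pᴷ⁺¹∣ =
    subst (_∣ binom) (*-identityʳ p) (≤ν⇒^∣ pp binom 1≤νC)
    where
    open ≤-Reasoning
    binom = (M + suc L) C (suc L)
    b = L ∸ a
    a+[1+b]≡1+L : a + suc b ≡ suc L
    a+[1+b]≡1+L = trans (+-suc a b) (cong suc (m+[n∸m]≡n a≤L))
    X = νFact a + νFact b
    νFact≤K+X : νFact (suc L) ≤ K + X
    νFact≤K+X = subst (λ t → νFact t ≤ K + X) a+[1+b]≡1+L
      (νFact[a+1+b]≤K+νFact[a]+νFact[b] a b K (subst (_< p ^ suc K) (sym a+[1+b]≡1+L) 1+L<pᴷ⁺¹))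
    chain : suc K + X ≤ ν p binom + K + X
    chain = begin
      suc K + X                 ≤⟨ +-monoˡ-≤ X (^∣⇒≤ν pp {k = suc K} (0<m+1+n M a) pᴷ⁺¹∣) ⟩
      ν p (M + suc a) + X       ≤⟨ ν+νFact+νFact≤νBlock M a b ⟩
      νBlock M (a + suc b)      ≡⟨ cong (νBlock M) a+[1+b]≡1+L ⟩
      νBlock M (suc L)          ≡⟨ νBlock≡ν[C]+νFact M (suc L) ⟩
      ν p binom + νFact (suc L) ≤⟨ +-monoʳ-≤ (ν p binom) νFact≤K+X ⟩
      ν p binom + (K + X)       ≡⟨ +-assoc (ν p binom) K X ⟨
      ν p binom + K + X         ∎
    1≤νC : 1 ≤ ν p binom
    1≤νC = +-cancelʳ-≤ K 1 (ν p binom) (+-cancelʳ-≤ X (suc K) (ν p binom + K) chain)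

-- Distributing prime powers over the positions

∏-updateAt-* : ∀ {n} (a : Fin n → ℕ) i c → foldr _*_ 1 (updateAt a i (c *_)) ≡ c * foldr _*_ 1 a
∏-updateAt-* a zero    c = *-assoc c (a zero) _
∏-updateAt-* a (suc i) c =
  trans (cong (a zero *_) (∏-updateAt-* (a ∘ suc) i c)) (x∙yz≈y∙xz (a zero) c _)

∏-const-1 : ∀ n → foldr _*_ 1 {n} (λ _ → 1) ≡ 1
∏-const-1 zero    = refl
∏-const-1 (suc n) = trans (*-identityˡ _) (∏-const-1 n)

∣∏ : ∀ {n} (a : Fin n → ℕ) i → a i ∣ foldr _*_ 1 a
∣∏ a zero    = m∣m*n _
∣∏ a (suc i) = ∣n⇒∣m*n (a zero) (∣∏ (a ∘ suc) i)

∣updateAt-* : ∀ {n} (a : Fin n → ℕ) i c j → a j ∣ updateAt a i (c *_) j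
∣updateAt-* a i c j with j ≟ᶠ i
... | yes refl = subst (a j ∣_) (sym (updateAt-updates j a)) (n∣m*n c)
... | no  j≢i  = ∣-reflexive (sym (updateAt-minimal j i a j≢i))

prime∣updateAt-prime^* : ∀ {n} (a : Fin n → ℕ) i j → Prime q → Prime p →
                         q ∣ updateAt a i (p ^ e *_) j → q ≡ p ⊎ q ∣ a j
prime∣updateAt-prime^* {e = e} a i j qp pp q∣ with j ≟ᶠ i
... | no  j≢i  = inj₂ (subst (_ ∣_) (updateAt-minimal j i a j≢i) q∣)
... | yes refl with euclidsLemma _ (a j) qp (subst (_ ∣_) (updateAt-updates j a) q∣)
...   | inj₁ q∣pᵉ = inj₁ (prime∣prime^⇒≡ qp pp e q∣pᵉ)
...   | inj₂ q∣aj = inj₂ q∣aj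

module _ {n : ℕ} (x : Fin n → ℕ) (site : ℕ → Fin n) where

  -- part-site is the invariant that later rules out parts equal to 1.
  record Distribution (N : ℕ) : Set where
    field
      part          : Fin n → ℕ
      ∏part         : N ≡ foldr _*_ 1 part
      part∣x        : ∀ i → part i ∣ x i
      part-disjoint : ∀ {i j} → i ≢ j → ∀ q → Prime q → q ∣ part i → q ∣ part j → ⊥
      part-site     : ∀ q → Prime q → q ∣ N → q ∣ part (site q)

  private
    Sited : ℕ → Set
    Sited N = ∀ p → Prime p → p ^ ν p N ∣ x (site p)

    trivial : Distribution 1
    trivial = record
      { part          = λ _ → 1
      ; ∏part         = sym (∏-const-1 n)
      ; part∣x        = λ i → 1∣ x i
      ; part-disjoint = λ _ q qp q∣1 _ → prime∤1 qp q∣1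
      ; part-site     = λ q qp q∣1 → contradiction q∣1 (prime∤1 qp)
      }

    extend : ∀ p e r → Prime p → ¬ p ∣ r → 0 < r →
             (Sited r → Distribution r) → Sited (p ^ e * r) → Distribution (p ^ e * r)
    extend p e r pp p∤r 0<r ih sited = record
      { part          = part
      ; ∏part         = trans (cong (p ^ e *_) ∏part′) (sym (∏-updateAt-* part′ (site p) (p ^ e)))
      ; part∣x        = part∣x
      ; part-disjoint = part-disjoint
      ; part-site     = part-site
      }
      where
      instance _ = prime⇒nonZero pp
      sitedʳ : Sited r
      sitedʳ q qp =
        ∣-trans (^-monoʳ-∣ q (ν-mono-∣ qp (m*n>0 (m^n>0 p e) 0<r) (n∣m*n (p ^ e)))) (sited q qp)
      open Distribution (ih sitedʳ) renaming
        ( part to part′; ∏part to ∏part′; part∣x to part′∣x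
        ; part-disjoint to part′-disjoint; part-site to part′-site)
      part : Fin n → ℕ
      part = updateAt part′ (site p) (p ^ e *_)
      p∤part′ : ∀ i → ¬ p ∣ part′ i
      p∤part′ i p∣ = p∤r (∣-trans p∣ (subst (part′ i ∣_) (sym ∏part′) (∣∏ part′ i)))
      p∣part⇒site : ∀ {i} → p ∣ part i → i ≡ site p
      p∣part⇒site {i} p∣ with i ≟ᶠ site p
      ... | yes i≡ = i≡
      ... | no  i≢ = contradiction (subst (p ∣_) (updateAt-minimal i (site p) part′ i≢) p∣) (p∤part′ i)
      part∣x : ∀ i → part i ∣ x i
      part∣x i with i ≟ᶠ site p
      ... | yes refl = subst (_∣ x i) (sym (updateAt-updates i part′))
        (prime^*∣ {e = e} pp (subst (λ k → p ^ k ∣ x i) (ν[pᵉ*r]≡e pp e p∤r) (sited p pp))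
                  (part′∣x i) (p∤part′ i))
      ... | no  i≢  = subst (_∣ x i) (sym (updateAt-minimal i (site p) part′ i≢)) (part′∣x i)
      part-disjoint : ∀ {i j} → i ≢ j → ∀ q → Prime q → q ∣ part i → q ∣ part j → ⊥
      part-disjoint {i} {j} i≢j q qp q∣i q∣j
        with prime∣updateAt-prime^* {e = e} part′ (site p) i qp pp q∣i
           | prime∣updateAt-prime^* {e = e} part′ (site p) j qp pp q∣j
      ... | inj₁ refl | _         = i≢j (trans (p∣part⇒site q∣i) (sym (p∣part⇒site q∣j)))
      ... | inj₂ _    | inj₁ refl = i≢j (trans (p∣part⇒site q∣i) (sym (p∣part⇒site q∣j)))
      ... | inj₂ q∣i′ | inj₂ q∣j′ = part′-disjoint i≢j q qp q∣i′ q∣j′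
      part-site : ∀ q → Prime q → q ∣ p ^ e * r → q ∣ part (site q)
      part-site q qp q∣ with euclidsLemma (p ^ e) r qp q∣
      ... | inj₁ q∣pᵉ with refl ← prime∣prime^⇒≡ qp pp e q∣pᵉ =
        subst (p ∣_) (sym (updateAt-updates (site p) part′)) (∣m⇒∣m*n (part′ (site p)) q∣pᵉ)
      ... | inj₂ q∣r = ∣-trans (part′-site q qp q∣r) (∣updateAt-* part′ (site p) (p ^ e) (site q))

  distribute : ∀ N → 0 < N → Sited N → Distribution N
  distribute = primePower-induction (λ N → Sited N → Distribution N) (λ _ → trivial) extend

-- The bound ∏ p ^ ⌊log_p n⌋

n<p^n : 1 < p → ∀ k → k < p ^ k
n<p^n     1<p zero    = z<s
n<p^n {p} 1<p (suc k) = ≤-<-trans (n<p^n 1<p k) (^-monoʳ-< p 1<p (n<1+n k))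

module _ {p n : ℕ} (1<p : 1 < p) where

  private instance
    p≢0 : NonZero p
    p≢0 = >-nonZero (<-trans z<s 1<p)

  countPow≤ : ∀ k → countPow p n k ≤ k
  countPow≤ zero    = z≤n
  countPow≤ (suc k) with p ^ suc k ≤? n
  ... | yes _ = s≤s (countPow≤ k)
  ... | no  _ = m≤n⇒m≤1+n (countPow≤ k)

  private
    countPow-exact-or-bound : 0 < n → ∀ k →
      (countPow p n k ≡ k × p ^ k ≤ n) ⊎ n < p ^ suc (countPow p n k)
    countPow-exact-or-bound 0<n zero = inj₁ (refl , 0<n)
    countPow-exact-or-bound 0<n (suc k) with countPow-exact-or-bound 0<n k | p ^ suc k ≤? n
    ... | inj₁ (c≡k , _) | yes pᵏ⁺¹≤n = inj₁ (cong suc c≡k , pᵏ⁺¹≤n)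
    ... | inj₁ (c≡k , _) | no  pᵏ⁺¹≰n = inj₂ (subst (λ c → n < p ^ suc c) (sym c≡k) (≰⇒> pᵏ⁺¹≰n))
    ... | inj₂ n<        | no  _      = inj₂ n<
    ... | inj₂ n<        | yes pᵏ⁺¹≤n =
      contradiction (≤-trans (^-monoʳ-≤ p (s≤s (countPow≤ k))) pᵏ⁺¹≤n) (<⇒≱ n<)

  n<p^[1+floorLog] : 0 < n → n < p ^ suc (floorLog p n)
  n<p^[1+floorLog] 0<n with countPow-exact-or-bound 0<n n
  ... | inj₁ (_ , pⁿ≤n) = contradiction pⁿ≤n (<⇒≱ (n<p^n 1<p n))
  ... | inj₂ n<         = n<

  countPow>0⇒p≤n : ∀ k → 0 < countPow p n k → p ≤ n
  countPow>0⇒p≤n (suc k) 0<c with p ^ suc k ≤? n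
  ... | yes pᵏ⁺¹≤n = ≤-trans (m≤m*n p (p ^ k) {{m^n≢0 p k}}) pᵏ⁺¹≤n
  ... | no  _      = countPow>0⇒p≤n k 0<c

primePowProdUpTo>0 : ∀ n k → 0 < primePowProdUpTo n k
primePowProdUpTo>0 n zero    = z<s
primePowProdUpTo>0 n (suc k) with prime? (suc k)
... | yes _ = m*n>0 (m^n>0 (suc k) (floorLog (suc k) n)) (primePowProdUpTo>0 n k)
... | no  _ = primePowProdUpTo>0 n k

p^floorLog∣primePowProdUpTo : ∀ n k → Prime p → p ≤ k → p ^ floorLog p n ∣ primePowProdUpTo n k
p^floorLog∣primePowProdUpTo n zero    pp p≤0 = contradiction p≤0 (<⇒≱ (<-trans z<s (prime⇒1< pp)))
p^floorLog∣primePowProdUpTo n (suc k) pp p≤ with prime? (suc k) | m≤n⇒m<n∨m≡n p≤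
... | yes _  | inj₂ refl = m∣m*n _
... | no  ¬p | inj₂ refl = contradiction pp ¬p
... | yes _  | inj₁ p<   =
  ∣n⇒∣m*n (suc k ^ floorLog (suc k) n) (p^floorLog∣primePowProdUpTo n k pp (s≤s⁻¹ p<))
... | no  _  | inj₁ p<   = p^floorLog∣primePowProdUpTo n k pp (s≤s⁻¹ p<)

noBigPower⇒∣primePowProd : ∀ n → 0 < x → (∀ q → Prime q → ¬ q ^ suc (floorLog q n) ∣ x) →
                           x ∣ primePowProd n
noBigPower⇒∣primePowProd {x} n 0<x noBigPower = ^ν∣⇒∣ 0<x qᵛ∣
  where
  qᵛ∣ : ∀ q → Prime q → q ^ ν q x ∣ primePowProd n
  qᵛ∣ q qp with ν q x ≤? floorLog q n
  ... | no  ν≰  = contradiction (≤ν⇒^∣ qp x (≰⇒> ν≰)) (noBigPower q qp)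
  ... | yes ν≤ with ν q x
  ...   | zero    = 1∣ _
  ...   | suc _   = ∣-trans (^-monoʳ-∣ q ν≤) (p^floorLog∣primePowProdUpTo n n qp
                      (countPow>0⇒p≤n (prime⇒1< qp) n (<-≤-trans z<s ν≤)))

∣m+j⇒∤m+i : ∀ {m i j} → q ∣ m + j → i < j → j < q → ¬ q ∣ m + i
∣m+j⇒∤m+i {q} {m} {i} {j} q∣m+j i<j j<q q∣m+i = <⇒≱ (≤-<-trans (m∸n≤m j i) j<q)
  (∣⇒≤ {{>-nonZero (m<n⇒0<n∸m i<j)}} (∣m+n∣m⇒∣n (subst (q ∣_) m+j≡ q∣m+j) q∣m+i))
  where
  m+j≡ : m + j ≡ m + i + (j ∸ i)
  m+j≡ = trans (cong (m +_) (sym (m+[n∸m]≡n (<⇒≤ i<j)))) (sym (+-assoc m i (j ∸ i)))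

∣m+i∧∣m+j⇒i≡j : ∀ {m i j} → q ∣ m + i → q ∣ m + j → i < q → j < q → i ≡ j
∣m+i∧∣m+j⇒i≡j {i = i} {j} q∣m+i q∣m+j i<q j<q with <-cmp i j
... | tri< i<j _ _ = contradiction q∣m+i (∣m+j⇒∤m+i q∣m+j i<j j<q)
... | tri≈ _ i≡j _ = i≡j
... | tri> _ _ j<i = contradiction q∣m+j (∣m+j⇒∤m+i q∣m+i j<i i<q)

-- The block m + 1, …, m + k + 1

module Window (m k : ℕ) where

  block : Fin (suc k) → ℕ
  block i = m + suc (toℕ i)

  binom : ℕ
  binom = (m + suc k) C (suc k)

  site : ℕ → Fin (suc k)
  site p = fromℕ< (s≤s (argmax≤ (λ i → ν p (m + suc i)) k))

  block[site]≡ : ∀ p → block (site p) ≡ m + suc (peak p m k)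
  block[site]≡ p = cong (λ t → m + suc t) (toℕ-fromℕ< _)

  νblock≤νblock[site] : ∀ p i → ν p (block i) ≤ ν p (block (site p))
  νblock≤νblock[site] p i = subst (λ t → ν p (block i) ≤ ν p t) (sym (block[site]≡ p))
    (argmax-maximal (λ i → ν p (m + suc i)) k (s≤s⁻¹ (toℕ<n i)))

  p^ν[binom]∣block[site] : ∀ p → Prime p → p ^ ν p binom ∣ block (site p)
  p^ν[binom]∣block[site] p pp = ≤ν⇒^∣ pp (block (site p))
    (subst (λ t → ν p binom ≤ ν p t) (sym (block[site]≡ p)) (Blocks.ν[C]≤ν[peak] pp m k))

  module _ {p} (pp : Prime p) {i : Fin (suc k)} where

    private
      K = floorLog p (suc k)
      1+i<pᴷ⁺¹ : ∀ i → suc (toℕ i) < p ^ suc K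
      1+i<pᴷ⁺¹ i = ≤-<-trans (toℕ<n i) (n<p^[1+floorLog] (prime⇒1< pp) z<s)

    bigPower⇒site : p ^ suc K ∣ block i → i ≡ site p
    bigPower⇒site pᴷ⁺¹∣blockᵢ = toℕ-injective (suc-injective
      (∣m+i∧∣m+j⇒i≡j pᴷ⁺¹∣blockᵢ pᴷ⁺¹∣block[site] (1+i<pᴷ⁺¹ i) (1+i<pᴷ⁺¹ (site p))))
      where
      pᴷ⁺¹∣block[site] : p ^ suc K ∣ block (site p)
      pᴷ⁺¹∣block[site] = ≤ν⇒^∣ pp (block (site p))
        (≤-trans (^∣⇒≤ν pp {k = suc K} (0<m+1+n m _) pᴷ⁺¹∣blockᵢ) (νblock≤νblock[site] p i))

    bigPower⇒p∣binom : p ^ suc K ∣ block i → p ∣ binom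
    bigPower⇒p∣binom = Blocks.bigPower⇒p∣C pp m k (toℕ i) K (s≤s⁻¹ (toℕ<n i))
      (n<p^[1+floorLog] (prime⇒1< pp) z<s)

  part>1 : primePowProd (suc k) < m → (D : Distribution block site binom) →
           ∀ i → 1 < Distribution.part D i
  part>1 L<m D i = ≤∧≢⇒< (n≢0⇒n>0 part≢0) (≢-sym part≢1)
    where
    open Distribution D
    part≢0 : part i ≢ 0
    part≢0 part≡0 = >⇒≢ (0<m+1+n m _) (0∣⇒≡0 (subst (_∣ block i) part≡0 (part∣x i)))
    noBigPower : part i ≡ 1 → ∀ q → Prime q → ¬ q ^ suc (floorLog q (suc k)) ∣ block i
    noBigPower part≡1 q qp qᴷ⁺¹∣blockᵢ = prime∤1 qp
      (subst (q ∣_) (trans (cong part (sym (bigPower⇒site qp qᴷ⁺¹∣blockᵢ))) part≡1)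
        (part-site q qp (bigPower⇒p∣binom qp qᴷ⁺¹∣blockᵢ)))
    part≢1 : part i ≢ 1
    part≢1 part≡1 = <⇒≱ (<-trans L<m (m<m+n m z<s))
      (∣⇒≤ {{>-nonZero (primePowProdUpTo>0 (suc k) (suc k))}}
        (noBigPower⇒∣primePowProd (suc k) (0<m+1+n m _) (noBigPower part≡1)))

theorem1 : (m n : ℕ) → 0 < m → 0 < n → m > primePowProd n →
  Σ (Fin n → ℕ) (λ a →
    ((m + n) C n ≡ foldr _*_ 1 a)
    × ((i : Fin n) → a i ∣ m + suc (toℕ i))
    × ((i : Fin n) → 1 < a i)
    × ((i j : Fin n) → i ≢ j → gcd (a i) (a j) ≡ 1))
theorem1 m (suc k) _ _ L<m = part , ∏part , part∣x , part>1 L<m D ,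
  λ i j i≢j → coprime⇒gcd≡1 (noCommonPrime⇒coprime (part-disjoint i≢j))
  where
  open Window m k
  D = distribute block site binom (C>0 m (suc k)) p^ν[binom]∣block[site]
  open Distribution D
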